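{- Let $p$ be the partially ordered pattern of length 4 whose occurrences in a permutation $\pi=\pi_1\cdots\pi_n$ are the subsequences $\pi_{i_1}\pi_{i_2}\pi_{i_3}\pi_{i_4}$ with $i_1<i_2<i_3<i_4$ such that $\pi_{i_2}<\pi_{i_1}$, $\pi_{i_4}<\pi_{i_1}$ and $\pi_{i_4}<\pi_{i_3}$. Let $a(n)$ be the number of permutations of $[n]$ avoiding $p$. Then $a(0)=a(1)=1$ and $a(n)=4a(n-1)-3a(n-2)+1$ for $n\geq 2$; consequently $a(n)=\frac{3^n-2n+3}{4}$ for all $n\ge 0$ and $$\sum_{n\geq 0}a(n)x^n=\frac{(1-2x)^2}{(1-3x)(1-x)^2}.$$
   Context: A permutation avoids a pattern if it contains no occurrence of it; the empty permutation counts for $n=0$. -}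

module Defs where

open import Data.Nat using (ℕ; zero; suc)
open import Data.Fin using (Fin; _<_; _<?_; _≟_)
open import Data.Fin.Properties using (any?; all?)
open import Data.Vec using (Vec; []; _∷_; lookup)
open import Data.List using (List; []; _∷_; [_]; length; filter; cartesianProductWith; allFin)
open import Data.Product using (∃; _×_)
open import Data.Integer using (ℤ; +_; _+_; _*_)
open import Relation.Binary.PropositionalEquality using (_≡_)
open import Relation.Nullary using (Dec; ¬_; ¬?; _×-dec_; _→-dec_)

allVecs : (n k : ℕ) → List (Vec (Fin n) k)
allVecs n zero    = [ [] ]
allVecs n (suc k) = cartesianProductWith _∷_ (allFin n) (allVecs n k)

IsPerm : {n : ℕ} → Vec (Fin n) n → Set
IsPerm {n} v = (i j : Fin n) → lookup v i ≡ lookup v j → i ≡ j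

isPerm? : {n : ℕ} → (v : Vec (Fin n) n) → Dec (IsPerm v)
isPerm? v = all? (λ i → all? (λ j → (lookup v i ≟ lookup v j) →-dec (i ≟ j)))

Occ : {n : ℕ} → Vec (Fin n) n → Fin n → Fin n → Fin n → Fin n → Set
Occ v i₁ i₂ i₃ i₄ =
  (i₁ < i₂) × (i₂ < i₃) × (i₃ < i₄) ×
  (lookup v i₂ < lookup v i₁) × (lookup v i₄ < lookup v i₁) × (lookup v i₄ < lookup v i₃)

Contains : {n : ℕ} → Vec (Fin n) n → Set
Contains v = ∃ λ i₁ → ∃ λ i₂ → ∃ λ i₃ → ∃ λ i₄ → Occ v i₁ i₂ i₃ i₄

Avoids : {n : ℕ} → Vec (Fin n) n → Set
Avoids v = ¬ Contains v

occ? : {n : ℕ} (v : Vec (Fin n) n) (i₁ i₂ i₃ i₄ : Fin n) → Dec (Occ v i₁ i₂ i₃ i₄)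
occ? v i₁ i₂ i₃ i₄ =
  (i₁ <? i₂) ×-dec (i₂ <? i₃) ×-dec (i₃ <? i₄) ×-dec
  (lookup v i₂ <? lookup v i₁) ×-dec (lookup v i₄ <? lookup v i₁) ×-dec (lookup v i₄ <? lookup v i₃)

avoids? : {n : ℕ} (v : Vec (Fin n) n) → Dec (Avoids v)
avoids? v = ¬? (any? λ i₁ → any? λ i₂ → any? λ i₃ → any? λ i₄ → occ? v i₁ i₂ i₃ i₄)

a : ℕ → ℕ
a n = length (filter (λ v → isPerm? v ×-dec avoids? v) (allVecs n n))

-- Formal power series as coefficient sequences ℕ → ℤ; polynomials as coefficient lists.
poly : List ℤ → ℕ → ℤ
poly []       _       = + 0
poly (c ∷ cs) zero    = c
poly (c ∷ cs) (suc n) = poly cs n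

polyMul : List ℤ → (ℕ → ℤ) → ℕ → ℤ
polyMul []       F n       = + 0
polyMul (c ∷ cs) F zero    = c * F zero
polyMul (c ∷ cs) F (suc n) = c * F (suc n) + polyMul cs F n

{-# OPTIONS --safe #-}
-- A permutation of [n+1] arises from one of [n] by prepending a first entry x and raising the entries ≥ x.
-- The new entry starts an occurrence of p exactly when the old permutation has a "tail" below x: entries
-- at positions i₂ < i₃ < i₄ with the ones at i₂ and i₄ smaller than x and π(i₄) < π(i₃). So x is admissible
-- iff x ≤ r, the largest value with no tail below it. The r of the new permutation is determined by x and
-- by s, the largest value below which no inversion ends: prepending 0 gives the labels (s+1, s+1), and
-- prepending x ≥ 1 to a permutation gives (0, max(s+1, x)), since 0 now ends an inversion. Thus a(n) counts
-- the nodes at depth n of the generating tree with root (0, 0) and these rules. For the generating functions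
-- G_k, F_k of the subtrees below (k, k) and (0, k) the rules read G_k = 1 + x(G_{k+1} + k F_{k+1}) and
-- F_k = (1 - x) F_{k+1}, so (1 - 2x)²(G_k - 1/(1 - x)) - x(k(1 - 2x) + x) F_k is x times the same expression
-- at k + 1 and hence zero. At k = 0, where G_0 = F_0 = Σ a(n) xⁿ, this is (1 - x)²(1 - 3x) Σ a(n) xⁿ = (1 - 2x)².
module Submission where

open import Defs
open import Data.Nat as ℕ using (ℕ; zero; suc; _+_; _*_; _^_; _⊔_; _≤_; z≤n; s≤s; _≤?_)
open import Data.Nat.Properties
  using ( +-identityʳ; *-identityˡ; *-identityʳ; +-suc; +-cancelʳ-≡; +-*-semiring
        ; ≤-refl; ≤-trans; ≤-pred; <⇒≤; <⇒≱; ≰⇒>; ≮⇒≥; n≤1+n; n<1+n; n≮n; <-irrefl; <-≤-trans; ≤-<-trans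
        ; ≤-antisym; m≤n⇒m≤1+n; m≤n⇒m<n∨m≡n; m≥n⇒m⊔n≡m; ⊔-lub; ⊔-sel; m≤n⇒m≤o⊔n; m≤n⇒m≤n⊔o )
open import Data.Nat.ListAction using () renaming (sum to listSum)
open import Data.Nat.ListAction.Properties using () renaming (sum-++ to listSum-++)
import Data.Nat.Tactic.RingSolver as ℕ-Solver
open import Data.Integer as ℤ using (ℤ; +_; -[1+_])
open import Data.Integer.Properties as ℤₚ using (pos-+; pos-*)
import Data.Integer.Tactic.RingSolver as ℤ-Solver
open import Data.Fin using (Fin; zero; suc; toℕ; inject₁; fromℕ; punchIn; punchOut; _<_; _<?_; _≟_)
open import Data.Fin.Properties
  using ( any?; pigeonhole; toℕ<n; toℕ-inject₁; toℕ-fromℕ; suc-injective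
        ; punchInᵢ≢i; punchIn-injective; punchIn-mono-≤; punchIn-cancel-≤; punchOut-injective )
open import Data.List as List using ([]; _∷_; length; filter; tabulate; cartesianProductWith; allFin)
import Data.List.Properties as List
open import Algebra.Properties.Semiring.Sum +-*-semiring
  using (sum-syntax; sum-cong-≗; sum-replicate-zero; sum-remove; sum-init-last; ∑-comm; *-distribˡ-sum)
open import Data.Product using (∃; ∃₂; _×_; _,_; proj₁)
open import Data.Sum using (_⊎_; inj₁; inj₂; [_,_])
open import Data.Bool using (if_then_else_)
open import Function using (_∘_)
open import Relation.Nullary using (Dec; yes; no; does; ¬_; ¬?; _×-dec_; contradiction)
open import Relation.Nullary.Decidable using (decidable-stable)
open import Relation.Unary using (Decidable)
open import Relation.Binary.PropositionalEquality hiding ([_])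
open ≡-Reasoning

𝟙 : {P : Set} → Dec P → ℕ
𝟙 (yes _) = 1
𝟙 (no _)  = 0

𝟙-yes : {P : Set} (P? : Dec P) → P → 𝟙 P? ≡ 1
𝟙-yes (yes _) _ = refl
𝟙-yes (no ¬p) p = contradiction p ¬p

𝟙-no : {P : Set} (P? : Dec P) → ¬ P → 𝟙 P? ≡ 0
𝟙-no (yes p) ¬p = contradiction p ¬p
𝟙-no (no _)  _  = refl

∑-const : ∀ n c → ∑[ i < n ] c ≡ n * c
∑-const zero    c = refl
∑-const (suc n) c = cong (_+_ c) (∑-const n c)

∑-snoc : ∀ n (f : ℕ → ℕ) → ∑[ i < suc n ] f (toℕ i) ≡ ∑[ i < n ] f (toℕ i) + f n
∑-snoc n f = begin
  ∑[ i < suc n ] f (toℕ i)                        ≡⟨ sum-init-last (λ i → f (toℕ i)) ⟩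
  ∑[ i < n ] f (toℕ (inject₁ i)) + f (toℕ (fromℕ n))
    ≡⟨ cong₂ _+_ (sum-cong-≗ {n} (cong f ∘ toℕ-inject₁)) (cong f (toℕ-fromℕ n)) ⟩
  ∑[ i < n ] f (toℕ i) + f n                       ∎

∑-truncate : ∀ {r} N (h : ℕ → ℕ) → r ℕ.< N →
  ∑[ x < N ] (𝟙 (toℕ x ≤? r) * h (toℕ x)) ≡ ∑[ x < suc r ] h (toℕ x)
∑-truncate {r} (suc N) h (s≤s r≤N) with m≤n⇒m<n∨m≡n r≤N
... | inj₂ refl = sum-cong-≗ {suc N} λ x →
  trans (cong (_* h (toℕ x)) (𝟙-yes (toℕ x ≤? N) (≤-pred (toℕ<n x)))) (*-identityˡ (h (toℕ x)))
... | inj₁ r<N = begin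
  ∑[ x < suc N ] (𝟙 (toℕ x ≤? r) * h (toℕ x))
    ≡⟨ ∑-snoc N (λ y → 𝟙 (y ≤? r) * h y) ⟩
  ∑[ x < N ] (𝟙 (toℕ x ≤? r) * h (toℕ x)) + 𝟙 (N ≤? r) * h N
    ≡⟨ cong₂ _+_ (∑-truncate N h r<N) (cong (_* h N) (𝟙-no (N ≤? r) (<⇒≱ r<N))) ⟩
  ∑[ x < suc r ] h (toℕ x) + 0
    ≡⟨ +-identityʳ _ ⟩
  ∑[ x < suc r ] h (toℕ x) ∎

-- The generating tree

childS : ℕ → ℕ → ℕ
childS s zero    = suc s
childS s (suc _) = zero

childR : ℕ → ℕ → ℕ
childR s x = suc s ⊔ x

treeCount : ℕ → ℕ → ℕ → ℕ
treeCount zero    s r = 1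
treeCount (suc m) s r = ∑[ x < suc r ] treeCount m (childS s (toℕ x)) (childR s (toℕ x))

treeCount-one : ∀ s r → treeCount 1 s r ≡ suc r
treeCount-one s r = trans (∑-const (suc r) 1) (*-identityʳ (suc r))

treeCount-diagonal : ∀ m k → treeCount (suc m) k k ≡ treeCount m (suc k) (suc k) + k * treeCount m 0 (suc k)
treeCount-diagonal m k = cong (_+_ (treeCount m (suc k) (suc k))) (begin
  ∑[ i < k ] treeCount m 0 (suc (k ⊔ toℕ i))
    ≡⟨ sum-cong-≗ {k} (λ i → cong (λ r → treeCount m 0 (suc r)) (m≥n⇒m⊔n≡m (<⇒≤ (toℕ<n i)))) ⟩
  ∑[ i < k ] treeCount m 0 (suc k)           ≡⟨ ∑-const k (treeCount m 0 (suc k)) ⟩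
  k * treeCount m 0 (suc k)                  ∎)

treeCount-widen : ∀ m r → treeCount (suc m) 0 (suc r) ≡ treeCount (suc m) 0 r + treeCount m 0 (suc r)
treeCount-widen m r = ∑-snoc (suc r) (λ x → treeCount m (childS 0 x) (childR 0 x))

invariant-step : ∀ k {g₁ g₂ g₃ G₀ G₁ G₂ f₁ f₂ F₀ F₁ F₂} →
  g₁ ≡ G₀ + k * F₀ → g₂ ≡ G₁ + k * F₁ → g₃ ≡ G₂ + k * F₂ → F₁ ≡ f₁ + F₀ → F₂ ≡ f₂ + F₁ →
  G₂ + 4 * G₀ + 2 * suc k * F₀ ≡ 4 * G₁ + suc k * F₁ + F₀ + 1 →
  g₃ + 4 * g₁ + 2 * k * f₁ ≡ 4 * g₂ + k * f₂ + f₁ + 1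
invariant-step k {G₀ = G₀} {G₁} {G₂} {f₁} {f₂} {F₀} refl refl refl refl refl ih =
  +-cancelʳ-≡ (2 * suc k * F₀) _ _ (begin
    G₂ + k * (f₂ + (f₁ + F₀)) + 4 * (G₀ + k * F₀) + 2 * k * f₁ + 2 * suc k * F₀
      ≡⟨ ℕ-Solver.solve (k ∷ G₀ ∷ G₂ ∷ f₁ ∷ f₂ ∷ F₀ ∷ []) ⟩
    (G₂ + 4 * G₀ + 2 * suc k * F₀) + (k * f₂ + 3 * k * f₁ + 5 * k * F₀)
      ≡⟨ cong (_+ (k * f₂ + 3 * k * f₁ + 5 * k * F₀)) ih ⟩
    (4 * G₁ + suc k * (f₁ + F₀) + F₀ + 1) + (k * f₂ + 3 * k * f₁ + 5 * k * F₀)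
      ≡⟨ ℕ-Solver.solve (k ∷ G₁ ∷ f₁ ∷ f₂ ∷ F₀ ∷ []) ⟩
    4 * (G₁ + k * (f₁ + F₀)) + k * f₂ + f₁ + 1 + 2 * suc k * F₀ ∎)

invariant-base : ∀ k {g₁ g₂ f₁} → g₂ ≡ suc (suc k) + k * suc (suc k) → g₁ ≡ suc k → f₁ ≡ suc k →
  g₂ + 4 * 1 + 2 * k * 1 ≡ 4 * g₁ + k * f₁ + 1 + 1
invariant-base k refl refl refl = ℕ-Solver.solve (k ∷ [])

-- The coefficient of x^(p+2) in (1 - 2x)²(G_k - 1/(1 - x)) - x(k(1 - 2x) + x) F_k, with subtractions moved across.
treeCount-invariant : ∀ p k →
  treeCount (2 + p) k k + 4 * treeCount p k k + 2 * k * treeCount p 0 k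
    ≡ 4 * treeCount (1 + p) k k + k * treeCount (1 + p) 0 k + treeCount p 0 k + 1
treeCount-invariant zero k = invariant-base k
  (trans (treeCount-diagonal 1 k) (cong₂ (λ x y → x + k * y) (treeCount-one (suc k) (suc k)) (treeCount-one 0 (suc k))))
  (treeCount-one k k) (treeCount-one 0 k)
treeCount-invariant (suc p) k = invariant-step k
  (treeCount-diagonal p k) (treeCount-diagonal (1 + p) k) (treeCount-diagonal (2 + p) k)
  (treeCount-widen p k) (treeCount-widen (1 + p) k) (treeCount-invariant p (suc k))

treeCount-recurrence : ∀ p → treeCount (2 + p) 0 0 + 3 * treeCount p 0 0 ≡ 4 * treeCount (1 + p) 0 0 + 1
treeCount-recurrence p = +-cancelʳ-≡ (treeCount p 0 0) _ _
  (rearrange (treeCount p 0 0) (treeCount (1 + p) 0 0) (treeCount (2 + p) 0 0) (treeCount-invariant p 0))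
  where
  rearrange : ∀ x₀ x₁ x₂ → x₂ + 4 * x₀ + 0 ≡ 4 * x₁ + 0 + x₀ + 1 → x₂ + 3 * x₀ + x₀ ≡ 4 * x₁ + 1 + x₀
  rearrange x₀ x₁ x₂ invariant = begin
    x₂ + 3 * x₀ + x₀          ≡⟨ ℕ-Solver.solve (x₀ ∷ x₂ ∷ []) ⟩
    x₂ + 4 * x₀ + 0           ≡⟨ invariant ⟩
    4 * x₁ + 0 + x₀ + 1       ≡⟨ ℕ-Solver.solve (x₀ ∷ x₁ ∷ []) ⟩
    4 * x₁ + 1 + x₀           ∎

-- Consequences of the recurrence

polyMul-singleton : ∀ c F n → polyMul (c ∷ []) F n ≡ c ℤ.* F n
polyMul-singleton c F zero    = refl
polyMul-singleton c F (suc n) = ℤₚ.+-identityʳ _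

third-order : ∀ x₀ x₁ x₂ x₃ →
  x₂ ℤ.+ + 3 ℤ.* x₀ ≡ + 4 ℤ.* x₁ ℤ.+ + 1 → x₃ ℤ.+ + 3 ℤ.* x₁ ≡ + 4 ℤ.* x₂ ℤ.+ + 1 →
  + 1 ℤ.* x₃ ℤ.+ (-[1+ 4 ] ℤ.* x₂ ℤ.+ (+ 7 ℤ.* x₁ ℤ.+ -[1+ 2 ] ℤ.* x₀)) ≡ + 0
third-order x₀ x₁ x₂ x₃ rec₀ rec₁ = begin
  + 1 ℤ.* x₃ ℤ.+ (-[1+ 4 ] ℤ.* x₂ ℤ.+ (+ 7 ℤ.* x₁ ℤ.+ -[1+ 2 ] ℤ.* x₀))
    ≡⟨ ℤ-Solver.solve (x₀ ∷ x₁ ∷ x₂ ∷ x₃ ∷ []) ⟩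
  (x₃ ℤ.+ + 3 ℤ.* x₁ ℤ.- (+ 4 ℤ.* x₂ ℤ.+ + 1)) ℤ.- (x₂ ℤ.+ + 3 ℤ.* x₀ ℤ.- (+ 4 ℤ.* x₁ ℤ.+ + 1))
    ≡⟨ cong₂ (λ y z → y ℤ.- (+ 4 ℤ.* x₂ ℤ.+ + 1) ℤ.- (z ℤ.- (+ 4 ℤ.* x₁ ℤ.+ + 1))) rec₁ rec₀ ⟩
  (+ 4 ℤ.* x₂ ℤ.+ + 1 ℤ.- (+ 4 ℤ.* x₂ ℤ.+ + 1)) ℤ.- (+ 4 ℤ.* x₁ ℤ.+ + 1 ℤ.- (+ 4 ℤ.* x₁ ℤ.+ + 1))
    ≡⟨ ℤ-Solver.solve (x₁ ∷ x₂ ∷ []) ⟩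
  + 0 ∎

closed-form-step : ∀ n e x₀ x₁ x₂ → x₂ + 3 * x₀ ≡ 4 * x₁ + 1 →
  4 * x₀ + 2 * n ≡ e + 3 → 4 * x₁ + 2 * (1 + n) ≡ 3 * e + 3 → 4 * x₂ + 2 * (2 + n) ≡ 3 * (3 * e) + 3
closed-form-step n e x₀ x₁ x₂ rec cf₀ cf₁ = +-cancelʳ-≡ (3 * (e + 3)) _ _ (begin
  4 * x₂ + 2 * (2 + n) + 3 * (e + 3)             ≡⟨ cong (λ y → 4 * x₂ + 2 * (2 + n) + 3 * y) cf₀ ⟨
  4 * x₂ + 2 * (2 + n) + 3 * (4 * x₀ + 2 * n)    ≡⟨ ℕ-Solver.solve (x₀ ∷ x₂ ∷ n ∷ []) ⟩
  4 * (x₂ + 3 * x₀) + 8 * n + 4                  ≡⟨ cong (λ y → 4 * y + 8 * n + 4) rec ⟩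
  4 * (4 * x₁ + 1) + 8 * n + 4                   ≡⟨ ℕ-Solver.solve (x₁ ∷ n ∷ []) ⟩
  4 * (4 * x₁ + 2 * (1 + n))                     ≡⟨ cong (4 *_) cf₁ ⟩
  4 * (3 * e + 3)                                ≡⟨ ℕ-Solver.solve (e ∷ []) ⟩
  (3 * (3 * e) + 3) + 3 * (e + 3)                ∎)

module _ (u : ℕ → ℕ) (u₀ : u 0 ≡ 1) (u₁ : u 1 ≡ 1)
         (recurrence : ∀ n → u (2 + n) + 3 * u n ≡ 4 * u (1 + n) + 1) where

  u₂ : u 2 ≡ 2
  u₂ = +-cancelʳ-≡ 3 _ _ (begin
    u 2 + 3 * 1     ≡⟨ cong (λ x → u 2 + 3 * x) (sym u₀) ⟩
    u 2 + 3 * u 0   ≡⟨ recurrence 0 ⟩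
    4 * u 1 + 1     ≡⟨ cong (λ x → 4 * x + 1) u₁ ⟩
    2 + 3           ∎)

  closed-form : ∀ n → 4 * u n + 2 * n ≡ 3 ^ n + 3
  closed-form zero          rewrite u₀ = refl
  closed-form (suc zero)    rewrite u₁ = refl
  closed-form (suc (suc n)) = closed-form-step n (3 ^ n) (u n) (u (1 + n)) (u (2 + n)) (recurrence n) (closed-form n) (closed-form (suc n))

  recurrenceℤ : ∀ n → + u (2 + n) ℤ.+ + 3 ℤ.* + u n ≡ + 4 ℤ.* + u (1 + n) ℤ.+ + 1
  recurrenceℤ n = begin
    + u (2 + n) ℤ.+ + 3 ℤ.* + u n   ≡⟨ cong (ℤ._+_ (+ u (2 + n))) (pos-* 3 (u n)) ⟨
    + u (2 + n) ℤ.+ + (3 * u n)     ≡⟨ pos-+ (u (2 + n)) (3 * u n) ⟨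
    + (u (2 + n) + 3 * u n)         ≡⟨ cong +_ (recurrence n) ⟩
    + (4 * u (1 + n) + 1)           ≡⟨ pos-+ (4 * u (1 + n)) 1 ⟩
    + (4 * u (1 + n)) ℤ.+ + 1       ≡⟨ cong (ℤ._+ + 1) (pos-* 4 (u (1 + n))) ⟩
    + 4 ℤ.* + u (1 + n) ℤ.+ + 1     ∎

  generating-function : ∀ n → polyMul (+ 1 ∷ -[1+ 4 ] ∷ + 7 ∷ -[1+ 2 ] ∷ []) (λ k → + u k) n
                                ≡ poly (+ 1 ∷ -[1+ 3 ] ∷ + 4 ∷ []) n
  generating-function zero                rewrite u₀ = refl
  generating-function (suc zero)          rewrite u₀ | u₁ = refl
  generating-function (suc (suc zero))    rewrite u₀ | u₁ | u₂ = refl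
  generating-function (suc (suc (suc n))) =
    trans (cong (λ y → + 1 ℤ.* + u (3 + n) ℤ.+ (-[1+ 4 ] ℤ.* + u (2 + n) ℤ.+ (+ 7 ℤ.* + u (1 + n) ℤ.+ y)))
                (polyMul-singleton -[1+ 2 ] (λ k → + u k) n))
          (third-order (+ u n) (+ u (1 + n)) (+ u (2 + n)) (+ u (3 + n)) (recurrenceℤ n) (recurrenceℤ (1 + n)))

-- Imported only here: an overloaded _∷_ breaks the ring-solver calls above.
open import Data.Vec using (Vec; []; _∷_; lookup; map)
open import Data.Vec.Properties using (lookup-map)

length-filter : ∀ {A : Set} {P : A → Set} (P? : Decidable P) xs →
  length (filter P? xs) ≡ listSum (List.map (𝟙 ∘ P?) xs)
length-filter P? []       = refl
length-filter P? (x ∷ xs) with P? x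
... | yes _ = cong suc (length-filter P? xs)
... | no _  = length-filter P? xs

sum-map-tabulate : ∀ {A : Set} n (g : A → ℕ) (f : Fin n → A) →
  listSum (List.map g (tabulate f)) ≡ ∑[ i < n ] g (f i)
sum-map-tabulate zero    g f = refl
sum-map-tabulate (suc n) g f = cong (_+_ (g (f zero))) (sum-map-tabulate n g (f ∘ suc))

sum-map-cartesianProduct : ∀ {A B C : Set} (f : C → ℕ) (_∙_ : A → B → C) xs ys →
  listSum (List.map f (cartesianProductWith _∙_ xs ys))
    ≡ listSum (List.map (λ x → listSum (List.map (f ∘ (x ∙_)) ys)) xs)
sum-map-cartesianProduct f _∙_ []       ys = refl
sum-map-cartesianProduct f _∙_ (x ∷ xs) ys = begin
  listSum (List.map f (List.map (x ∙_) ys List.++ cartesianProductWith _∙_ xs ys))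
    ≡⟨ cong listSum (List.map-++ f (List.map (x ∙_) ys) _) ⟩
  listSum (List.map f (List.map (x ∙_) ys) List.++ List.map f (cartesianProductWith _∙_ xs ys))
    ≡⟨ listSum-++ (List.map f (List.map (x ∙_) ys)) _ ⟩
  listSum (List.map f (List.map (x ∙_) ys)) + listSum (List.map f (cartesianProductWith _∙_ xs ys))
    ≡⟨ cong₂ _+_ (sym (cong listSum (List.map-∘ ys))) (sum-map-cartesianProduct f _∙_ xs ys) ⟩
  listSum (List.map (f ∘ (x ∙_)) ys) + listSum (List.map (λ x → listSum (List.map (f ∘ (x ∙_)) ys)) xs) ∎

∑Words : ∀ m k → (Vec (Fin m) k → ℕ) → ℕ
∑Words m zero    f = f []
∑Words m (suc k) f = ∑[ x < m ] ∑Words m k (λ w → f (x ∷ w))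

sum-map-allVecs : ∀ m k (f : Vec (Fin m) k → ℕ) → listSum (List.map f (allVecs m k)) ≡ ∑Words m k f
sum-map-allVecs m zero    f = +-identityʳ (f [])
sum-map-allVecs m (suc k) f = begin
  listSum (List.map f (cartesianProductWith _∷_ (allFin m) (allVecs m k)))
    ≡⟨ sum-map-cartesianProduct f _∷_ (allFin m) (allVecs m k) ⟩
  listSum (List.map (λ x → listSum (List.map (f ∘ (x ∷_)) (allVecs m k))) (allFin m))
    ≡⟨ sum-map-tabulate m _ (λ x → x) ⟩
  ∑[ x < m ] listSum (List.map (f ∘ (x ∷_)) (allVecs m k))
    ≡⟨ sum-cong-≗ {m} (λ x → sum-map-allVecs m k (f ∘ (x ∷_))) ⟩
  ∑Words m (suc k) f ∎

count-allVecs : ∀ m k {P : Vec (Fin m) k → Set} (P? : Decidable P) →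
  length (filter P? (allVecs m k)) ≡ ∑Words m k (𝟙 ∘ P?)
count-allVecs m k P? = trans (length-filter P? (allVecs m k)) (sum-map-allVecs m k (𝟙 ∘ P?))

∑Words-cong : ∀ m k {f g : Vec (Fin m) k → ℕ} → (∀ w → f w ≡ g w) → ∑Words m k f ≡ ∑Words m k g
∑Words-cong m zero    f≗g = f≗g []
∑Words-cong m (suc k) f≗g = sum-cong-≗ {m} (λ x → ∑Words-cong m k (f≗g ∘ (x ∷_)))

∑Words-zero : ∀ m k {f : Vec (Fin m) k → ℕ} → (∀ w → f w ≡ 0) → ∑Words m k f ≡ 0
∑Words-zero m zero    f≗0 = f≗0 []
∑Words-zero m (suc k) f≗0 =
  trans (sum-cong-≗ {m} (λ x → ∑Words-zero m k (f≗0 ∘ (x ∷_)))) (sum-replicate-zero m)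

∑Words-comm : ∀ m k n (f : Vec (Fin m) k → Fin n → ℕ) →
  ∑Words m k (λ w → ∑[ x < n ] f w x) ≡ ∑[ x < n ] ∑Words m k (λ w → f w x)
∑Words-comm m zero    n f = refl
∑Words-comm m (suc k) n f = trans (sum-cong-≗ {m} (λ y → ∑Words-comm m k n (f ∘ (y ∷_))))
                                  (∑-comm (λ y x → ∑Words m k (λ w → f (y ∷ w) x)))

∑Words-punchIn : ∀ n k (x : Fin (suc n)) {f : Vec (Fin (suc n)) k → ℕ} →
  (∀ w i → lookup w i ≡ x → f w ≡ 0) → ∑Words (suc n) k f ≡ ∑Words n k (f ∘ map (punchIn x))
∑Words-punchIn n zero    x vanish = refl
∑Words-punchIn n (suc k) x {f} vanish = begin
  ∑[ y < suc n ] ∑Words (suc n) k (λ w → f (y ∷ w))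
    ≡⟨ sum-remove {i = x} (λ y → ∑Words (suc n) k (λ w → f (y ∷ w))) ⟩
  ∑Words (suc n) k (λ w → f (x ∷ w)) + ∑[ y < n ] ∑Words (suc n) k (λ w → f (punchIn x y ∷ w))
    ≡⟨ cong₂ _+_ (∑Words-zero (suc n) k (λ w → vanish (x ∷ w) zero refl))
                 (sum-cong-≗ {n} (λ y → ∑Words-punchIn n k x (λ w i → vanish (punchIn x y ∷ w) (suc i)))) ⟩
  ∑[ y < n ] ∑Words n k (λ u → f (punchIn x y ∷ map (punchIn x) u)) ∎

largest : {P : ℕ → Set} → Decidable P → ℕ → ℕ
largest P? zero    = zero
largest P? (suc n) = if does (P? (suc n)) then suc n else largest P? n

largest-≤ : {P : ℕ → Set} (P? : Decidable P) (n : ℕ) → largest P? n ≤ n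
largest-≤ P? zero = z≤n
largest-≤ P? (suc n) with P? (suc n)
... | yes _ = ≤-refl
... | no _  = m≤n⇒m≤1+n (largest-≤ P? n)

P⇒≤-largest : {P : ℕ → Set} (P? : Decidable P) → ∀ {n t} → t ≤ n → P t → t ≤ largest P? n
P⇒≤-largest P? {zero}  t≤0   _  = t≤0
P⇒≤-largest P? {suc n} t≤1+n Pt with P? (suc n) | m≤n⇒m<n∨m≡n t≤1+n
... | yes _   | _              = t≤1+n
... | no ¬P   | inj₂ refl      = contradiction Pt ¬P
... | no _    | inj₁ (s≤s t≤n) = P⇒≤-largest P? t≤n Pt

module _ {P : ℕ → Set} (P? : Decidable P) (P-down : ∀ {s t} → s ≤ t → P t → P s) (P0 : P 0) where

  ≤-largest⇒P : ∀ {n t} → t ≤ largest P? n → P t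
  ≤-largest⇒P {zero}  t≤0 = P-down t≤0 P0
  ≤-largest⇒P {suc n} t≤ℓ with P? (suc n)
  ... | yes P1+n = P-down t≤ℓ P1+n
  ... | no _     = ≤-largest⇒P {n} t≤ℓ

  largest-unique : ∀ {n c} → c ≤ n → (∀ {t} → t ≤ c → P t) → (∀ {t} → t ≤ n → P t → t ≤ c) →
                   largest P? n ≡ c
  largest-unique {n} c≤n below above = ≤-antisym
    (above (largest-≤ P? n) (≤-largest⇒P {n} ≤-refl))
    (P⇒≤-largest P? c≤n (below ≤-refl))

punchIn-mono-< : ∀ {n} (x : Fin (suc n)) {a b : Fin n} → a < b → punchIn x a < punchIn x b
punchIn-mono-< x {a} {b} a<b = ≰⇒> (λ ιb≤ιa → <⇒≱ a<b (punchIn-cancel-≤ x b a ιb≤ιa))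

punchIn-cancel-< : ∀ {n} (x : Fin (suc n)) {a b : Fin n} → punchIn x a < punchIn x b → a < b
punchIn-cancel-< x {a} {b} ιa<ιb = ≰⇒> (λ b≤a → <⇒≱ ιa<ιb (punchIn-mono-≤ x b a b≤a))

toℕ-punchIn-< : ∀ {n} (x : Fin (suc n)) (a : Fin n) → toℕ a ℕ.< toℕ x → toℕ (punchIn x a) ≡ toℕ a
toℕ-punchIn-< (suc x) zero    _         = refl
toℕ-punchIn-< (suc x) (suc a) (s≤s a<x) = cong suc (toℕ-punchIn-< x a a<x)

toℕ≤toℕ-punchIn : ∀ {n} (x : Fin (suc n)) (a : Fin n) → toℕ a ≤ toℕ (punchIn x a)
toℕ≤toℕ-punchIn zero    a       = n≤1+n (toℕ a)
toℕ≤toℕ-punchIn (suc x) zero    = z≤n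
toℕ≤toℕ-punchIn (suc x) (suc a) = s≤s (toℕ≤toℕ-punchIn x a)

toℕ-punchIn≤suc : ∀ {n} (x : Fin (suc n)) (a : Fin n) → toℕ (punchIn x a) ≤ suc (toℕ a)
toℕ-punchIn≤suc zero    a       = ≤-refl
toℕ-punchIn≤suc (suc x) zero    = z≤n
toℕ-punchIn≤suc (suc x) (suc a) = s≤s (toℕ-punchIn≤suc x a)

toℕ-punchIn≤⇒< : ∀ {n} (x : Fin (suc n)) (a : Fin n) → toℕ (punchIn x a) ≤ toℕ a → toℕ a ℕ.< toℕ x
toℕ-punchIn≤⇒< zero    a       ιa≤a      = contradiction ιa≤a (n≮n (toℕ a))
toℕ-punchIn≤⇒< (suc x) zero    _         = s≤s z≤n
toℕ-punchIn≤⇒< (suc x) (suc a) (s≤s ιa≤a) = s≤s (toℕ-punchIn≤⇒< x a ιa≤a)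

InversionBelow : ∀ {m k} → Vec (Fin m) k → ℕ → Set
InversionBelow {k = k} w y = ∃₂ λ (i j : Fin k) →
  i < j × lookup w j < lookup w i × toℕ (lookup w j) ℕ.< y

-- Positions 2–4 of an occurrence of p whose first entry would be y.
TailBelow : ∀ {m k} → Vec (Fin m) k → ℕ → Set
TailBelow {k = k} w y = ∃ λ (i₂ : Fin k) → ∃₂ λ (i₃ i₄ : Fin k) →
  i₂ < i₃ × i₃ < i₄ × toℕ (lookup w i₂) ℕ.< y × toℕ (lookup w i₄) ℕ.< y × lookup w i₄ < lookup w i₃

inversionBelow? : ∀ {m k} (w : Vec (Fin m) k) y → Dec (InversionBelow w y)
inversionBelow? w y = any? λ i → any? λ j →
  (i <? j) ×-dec (lookup w j <? lookup w i) ×-dec (toℕ (lookup w j) ℕ.<? y)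

tailBelow? : ∀ {m k} (w : Vec (Fin m) k) y → Dec (TailBelow w y)
tailBelow? w y = any? λ i₂ → any? λ i₃ → any? λ i₄ →
  (i₂ <? i₃) ×-dec (i₃ <? i₄) ×-dec (toℕ (lookup w i₂) ℕ.<? y) ×-dec (toℕ (lookup w i₄) ℕ.<? y)
  ×-dec (lookup w i₄ <? lookup w i₃)

InversionBelow-mono : ∀ {m k} (w : Vec (Fin m) k) {y y′} → y ≤ y′ → InversionBelow w y → InversionBelow w y′
InversionBelow-mono w y≤y′ (i , j , i<j , inv , below) = i , j , i<j , inv , <-≤-trans below y≤y′

TailBelow-mono : ∀ {m k} (w : Vec (Fin m) k) {y y′} → y ≤ y′ → TailBelow w y → TailBelow w y′
TailBelow-mono w y≤y′ (i₂ , i₃ , i₄ , i₂<i₃ , i₃<i₄ , b₂ , b₄ , inv) =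
  i₂ , i₃ , i₄ , i₂<i₃ , i₃<i₄ , <-≤-trans b₂ y≤y′ , <-≤-trans b₄ y≤y′ , inv

sLabel : ∀ {n} → Vec (Fin n) n → ℕ
sLabel {n} u = largest (λ t → ¬? (inversionBelow? u t)) n

rLabel : ∀ {n} → Vec (Fin n) n → ℕ
rLabel {n} u = largest (λ t → ¬? (tailBelow? u t)) n

module _ {n} (u : Vec (Fin n) n) where

  ≤-sLabel⇒¬InversionBelow : ∀ {t} → t ≤ sLabel u → ¬ InversionBelow u t
  ≤-sLabel⇒¬InversionBelow = ≤-largest⇒P (λ t → ¬? (inversionBelow? u t))
    (λ s≤t ¬inv inv → ¬inv (InversionBelow-mono u s≤t inv)) (λ ()) {n}

  ¬InversionBelow⇒≤-sLabel : ∀ {t} → t ≤ n → ¬ InversionBelow u t → t ≤ sLabel u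
  ¬InversionBelow⇒≤-sLabel = P⇒≤-largest (λ t → ¬? (inversionBelow? u t))

  ≤-rLabel⇒¬TailBelow : ∀ {t} → t ≤ rLabel u → ¬ TailBelow u t
  ≤-rLabel⇒¬TailBelow = ≤-largest⇒P (λ t → ¬? (tailBelow? u t))
    (λ s≤t ¬tail tail → ¬tail (TailBelow-mono u s≤t tail)) (λ ()) {n}

  ¬TailBelow⇒≤-rLabel : ∀ {t} → t ≤ n → ¬ TailBelow u t → t ≤ rLabel u
  ¬TailBelow⇒≤-rLabel = P⇒≤-largest (λ t → ¬? (tailBelow? u t))

  sLabel-≤ : sLabel u ≤ n
  sLabel-≤ = largest-≤ (λ t → ¬? (inversionBelow? u t)) n

  rLabel-≤ : rLabel u ≤ n
  rLabel-≤ = largest-≤ (λ t → ¬? (tailBelow? u t)) n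

  sLabel<⇒InversionBelow : ∀ {t} → t ≤ n → sLabel u ℕ.< t → InversionBelow u t
  sLabel<⇒InversionBelow t≤n s<t = decidable-stable (inversionBelow? u _)
    (λ ¬inv → <⇒≱ s<t (¬InversionBelow⇒≤-sLabel t≤n ¬inv))

  rLabel<⇒TailBelow : ∀ {t} → t ≤ n → rLabel u ℕ.< t → TailBelow u t
  rLabel<⇒TailBelow t≤n r<t = decidable-stable (tailBelow? u _)
    (λ ¬tail → <⇒≱ r<t (¬TailBelow⇒≤-rLabel t≤n ¬tail))

module _ {m k} (x : Fin m) (w : Vec (Fin m) k) where

  TailBelow-∷⇒InversionBelow : ∀ {t} → TailBelow (x ∷ w) t → InversionBelow w t
  TailBelow-∷⇒InversionBelow (_ , suc j₃ , suc j₄ , _ , s≤s j₃<j₄ , _ , b₄ , inv) = j₃ , j₄ , j₃<j₄ , inv , b₄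

  InversionBelow-∷ : ∀ {t} → InversionBelow w t → InversionBelow (x ∷ w) t
  InversionBelow-∷ (i , j , i<j , inv , b) = suc i , suc j , s≤s i<j , inv , b

  InversionBelow⇒TailBelow-∷ : ∀ {t} → toℕ x ℕ.< t → InversionBelow w t → TailBelow (x ∷ w) t
  InversionBelow⇒TailBelow-∷ x<t (i , j , i<j , inv , b) = zero , suc i , suc j , s≤s z≤n , s≤s i<j , x<t , b , inv

  TailBelow-∷⇒TailBelow : ∀ {t} → t ≤ toℕ x → TailBelow (x ∷ w) t → TailBelow w t
  TailBelow-∷⇒TailBelow t≤x (zero , _ , _ , _ , _ , x<t , _) = contradiction t≤x (<⇒≱ x<t)
  TailBelow-∷⇒TailBelow t≤x (suc j₂ , suc j₃ , suc j₄ , s≤s j₂<j₃ , s≤s j₃<j₄ , b₂ , b₄ , inv) =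
    j₂ , j₃ , j₄ , j₂<j₃ , j₃<j₄ , b₂ , b₄ , inv

-- Prepending a first entry

prepend : ∀ {n} → Fin (suc n) → Vec (Fin n) n → Vec (Fin (suc n)) (suc n)
prepend x u = x ∷ map (punchIn x) u

module _ {n} (x : Fin (suc n)) (u : Vec (Fin n) n) where

  private
    ι : Fin n → Fin (suc n)
    ι = punchIn x

    lookup-ι : ∀ j → toℕ (lookup (map ι u) j) ≡ toℕ (ι (lookup u j))
    lookup-ι j = cong toℕ (lookup-map j ι u)

  IsPerm-prepend : IsPerm u → IsPerm (prepend x u)
  IsPerm-prepend perm zero    zero    _ = refl
  IsPerm-prepend perm zero    (suc j) e = contradiction (sym (trans e (lookup-map j ι u))) (punchInᵢ≢i x _)
  IsPerm-prepend perm (suc i) zero    e = contradiction (trans (sym (lookup-map i ι u)) e) (punchInᵢ≢i x _)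
  IsPerm-prepend perm (suc i) (suc j) e = cong suc (perm i j (punchIn-injective x _ _
    (trans (sym (lookup-map i ι u)) (trans e (lookup-map j ι u)))))

  IsPerm-prepend⁻ : IsPerm (prepend x u) → IsPerm u
  IsPerm-prepend⁻ perm i j e = suc-injective (perm (suc i) (suc j)
    (trans (lookup-map i ι u) (trans (cong ι e) (sym (lookup-map j ι u)))))

  InversionBelow-punchIn⁺ : ∀ {t} → InversionBelow u t → InversionBelow (map ι u) (suc t)
  InversionBelow-punchIn⁺ (i , j , i<j , inv , b) = i , j , i<j ,
    subst₂ ℕ._<_ (sym (lookup-ι j)) (sym (lookup-ι i)) (punchIn-mono-< x inv) ,
    subst (ℕ._< suc _) (sym (lookup-ι j)) (≤-<-trans (toℕ-punchIn≤suc x _) (s≤s b))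

  InversionBelow-punchIn⇒< : ∀ {s} → ¬ InversionBelow u s → InversionBelow (map ι u) (suc s) → s ℕ.< toℕ x
  InversionBelow-punchIn⇒< {s} ¬inv (i , j , i<j , inv , b) rewrite lookup-ι i | lookup-ι j =
    ≤-<-trans s≤uⱼ (toℕ-punchIn≤⇒< x (lookup u j) (≤-trans (≤-pred b) s≤uⱼ))
    where
    s≤uⱼ : s ≤ toℕ (lookup u j)
    s≤uⱼ = ≮⇒≥ (λ uⱼ<s → ¬inv (i , j , i<j , punchIn-cancel-< x inv , uⱼ<s))

  TailBelow-punchIn⁻ : TailBelow (map ι u) (toℕ x) → TailBelow u (toℕ x)
  TailBelow-punchIn⁻ (i₂ , i₃ , i₄ , i₂<i₃ , i₃<i₄ , b₂ , b₄ , inv) rewrite lookup-ι i₂ | lookup-ι i₃ | lookup-ι i₄ =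
    i₂ , i₃ , i₄ , i₂<i₃ , i₃<i₄ , ≤-<-trans (toℕ≤toℕ-punchIn x _) b₂ , ≤-<-trans (toℕ≤toℕ-punchIn x _) b₄ ,
    punchIn-cancel-< x inv

  Contains-prepend⁺ : Contains u → Contains (prepend x u)
  Contains-prepend⁺ (j₁ , j₂ , j₃ , j₄ , j₁<j₂ , j₂<j₃ , j₃<j₄ , inv₂₁ , inv₄₁ , inv₄₃) =
    suc j₁ , suc j₂ , suc j₃ , suc j₄ , s≤s j₁<j₂ , s≤s j₂<j₃ , s≤s j₃<j₄ ,
    ι-< j₂ j₁ inv₂₁ , ι-< j₄ j₁ inv₄₁ , ι-< j₄ j₃ inv₄₃
    where
    ι-< : ∀ i j → lookup u i < lookup u j → lookup (map ι u) i < lookup (map ι u) j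
    ι-< i j lt = subst₂ ℕ._<_ (sym (lookup-ι i)) (sym (lookup-ι j)) (punchIn-mono-< x lt)

  TailBelow⇒Contains-prepend : TailBelow u (toℕ x) → Contains (prepend x u)
  TailBelow⇒Contains-prepend (j₂ , j₃ , j₄ , j₂<j₃ , j₃<j₄ , b₂ , b₄ , inv) =
    zero , suc j₂ , suc j₃ , suc j₄ , s≤s z≤n , s≤s j₂<j₃ , s≤s j₃<j₄ , ι-<x j₂ b₂ , ι-<x j₄ b₄ ,
    subst₂ ℕ._<_ (sym (lookup-ι j₄)) (sym (lookup-ι j₃)) (punchIn-mono-< x inv)
    where
    ι-<x : ∀ j → toℕ (lookup u j) ℕ.< toℕ x → toℕ (lookup (map ι u) j) ℕ.< toℕ x
    ι-<x j lt = subst (ℕ._< toℕ x) (sym (trans (lookup-ι j) (toℕ-punchIn-< x _ lt))) lt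

  Contains-prepend⁻ : Contains (prepend x u) → Contains u ⊎ TailBelow u (toℕ x)
  Contains-prepend⁻ (zero , suc j₂ , suc j₃ , suc j₄ , _ , s≤s j₂<j₃ , s≤s j₃<j₄ , b₂ , b₄ , inv) =
    inj₂ (TailBelow-punchIn⁻ (j₂ , j₃ , j₄ , j₂<j₃ , j₃<j₄ , b₂ , b₄ , inv))
  Contains-prepend⁻ (suc j₁ , suc j₂ , suc j₃ , suc j₄ , s≤s j₁<j₂ , s≤s j₂<j₃ , s≤s j₃<j₄ , inv₂₁ , inv₄₁ , inv₄₃) =
    inj₁ (j₁ , j₂ , j₃ , j₄ , j₁<j₂ , j₂<j₃ , j₃<j₄ , ι-cancel j₂ j₁ inv₂₁ , ι-cancel j₄ j₁ inv₄₁ , ι-cancel j₄ j₃ inv₄₃)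
    where
    ι-cancel : ∀ i j → lookup (map ι u) i < lookup (map ι u) j → lookup u i < lookup u j
    ι-cancel i j lt = punchIn-cancel-< x (subst₂ ℕ._<_ (lookup-ι i) (lookup-ι j) lt)

IsPerm⇒∃≡zero : ∀ {n} (u : Vec (Fin (suc n)) (suc n)) → IsPerm u → ∃ λ j → lookup u j ≡ zero
IsPerm⇒∃≡zero {n} u perm = decidable-stable (any? λ j → lookup u j ≟ zero) λ ¬hit →
  let 0≢ : ∀ j → zero ≢ lookup u j
      0≢ j 0≡uⱼ = ¬hit (j , sym 0≡uⱼ)
      (i , j , i<j , eq) = pigeonhole (n<1+n n) (λ j → punchOut (0≢ j))
  in <-irrefl (cong toℕ (perm i j (punchOut-injective (0≢ i) (0≢ j) eq))) i<j

sLabel-prepend-zero : ∀ {n} (u : Vec (Fin n) n) → sLabel (prepend zero u) ≡ suc (sLabel u)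
sLabel-prepend-zero {n} u = largest-unique (λ t → ¬? (inversionBelow? (prepend zero u) t))
  (λ s≤t ¬inv inv → ¬inv (InversionBelow-mono (prepend zero u) s≤t inv)) (λ ())
  (s≤s (sLabel-≤ u)) below above
  where
  lower : ∀ {t} → InversionBelow (prepend zero u) (suc t) → InversionBelow u t
  lower (suc i , suc j , s≤s i<j , inv , b) =
    i , j , i<j , ≤-pred (subst₂ ℕ._<_ (lookup-suc j) (lookup-suc i) inv) , ≤-pred (subst (ℕ._< suc _) (lookup-suc j) b)
    where
    lookup-suc : ∀ k → toℕ (lookup (map suc u) k) ≡ suc (toℕ (lookup u k))
    lookup-suc k = cong toℕ (lookup-map k suc u)
  below : ∀ {t} → t ≤ suc (sLabel u) → ¬ InversionBelow (prepend zero u) t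
  below {zero}  _          ()
  below {suc t} (s≤s t≤s) inv = ≤-sLabel⇒¬InversionBelow u t≤s (lower inv)
  above : ∀ {t} → t ≤ suc n → ¬ InversionBelow (prepend zero u) t → t ≤ suc (sLabel u)
  above {zero}  _          _    = z≤n
  above {suc t} (s≤s t≤n) ¬inv = s≤s (¬InversionBelow⇒≤-sLabel u t≤n (¬inv ∘ raise))
    where
    raise : InversionBelow u t → InversionBelow (prepend zero u) (suc t)
    raise inv = InversionBelow-∷ zero (map suc u) (InversionBelow-punchIn⁺ zero u inv)

sLabel-prepend-suc : ∀ {n} (x : Fin (suc n)) (u : Vec (Fin (suc n)) (suc n)) → IsPerm u →
  sLabel (prepend (suc x) u) ≡ 0
sLabel-prepend-suc {n} x u perm = largest-unique (λ t → ¬? (inversionBelow? v t))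
  (λ s≤t ¬inv inv → ¬inv (InversionBelow-mono v s≤t inv)) (λ ()) z≤n below above
  where
  v : Vec (Fin (suc (suc n))) (suc (suc n))
  v = prepend (suc x) u
  below : ∀ {t} → t ≤ 0 → ¬ InversionBelow v t
  below z≤n ()
  above : ∀ {t} → t ≤ suc (suc n) → ¬ InversionBelow v t → t ≤ 0
  above {zero}  _ _    = z≤n
  above {suc t} _ ¬inv with IsPerm⇒∃≡zero u perm
  ... | j , uⱼ≡0 = contradiction (zero , suc j , s≤s z≤n , 0<ᵥ (s≤s z≤n) , 0<ᵥ (s≤s z≤n)) ¬inv
    where
    vⱼ≡0 : lookup (map (punchIn (suc x)) u) j ≡ zero
    vⱼ≡0 = trans (lookup-map j (punchIn (suc x)) u) (cong (punchIn (suc x)) uⱼ≡0)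
    0<ᵥ : ∀ {y} → 0 ℕ.< y → toℕ (lookup (map (punchIn (suc x)) u) j) ℕ.< y
    0<ᵥ = subst (ℕ._< _) (sym (cong toℕ vⱼ≡0))

rLabel-prepend : ∀ {n} (x : Fin (suc n)) (u : Vec (Fin n) n) → ¬ TailBelow u (toℕ x) →
  rLabel (prepend x u) ≡ childR (sLabel u) (toℕ x)
rLabel-prepend {n} x u ¬tail = largest-unique (λ t → ¬? (tailBelow? v t))
  (λ s≤t ¬tailᵥ tailᵥ → ¬tailᵥ (TailBelow-mono v s≤t tailᵥ)) (λ ())
  (⊔-lub (s≤s (sLabel-≤ u)) (<⇒≤ (toℕ<n x))) below above
  where
  v : Vec (Fin (suc n)) (suc n)
  v = prepend x u
  s : ℕ
  s = sLabel u
  w : Vec (Fin (suc n)) n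
  w = map (punchIn x) u
  below : ∀ {t} → t ≤ suc s ⊔ toℕ x → ¬ TailBelow v t
  below {t} t≤c tailᵥ with t ≤? toℕ x
  ... | yes t≤x = ¬tail (TailBelow-punchIn⁻ x u (TailBelow-mono w t≤x (TailBelow-∷⇒TailBelow x w t≤x tailᵥ)))
  ... | no t≰x = t≰x (≤-trans t≤1+s (InversionBelow-punchIn⇒< x u (≤-sLabel⇒¬InversionBelow u ≤-refl)
                   (InversionBelow-mono w t≤1+s (TailBelow-∷⇒InversionBelow x w tailᵥ))))
    where
    t≤1+s : t ≤ suc s
    t≤1+s with ⊔-sel (suc s) (toℕ x)
    ... | inj₁ c≡1+s = subst (t ≤_) c≡1+s t≤c
    ... | inj₂ c≡x   = contradiction (subst (t ≤_) c≡x t≤c) t≰x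
  above : ∀ {t} → t ≤ suc n → ¬ TailBelow v t → t ≤ suc s ⊔ toℕ x
  above {t} t≤1+n ¬tailᵥ with t ≤? toℕ x | t ≤? suc s
  ... | yes t≤x | _         = m≤n⇒m≤o⊔n (suc s) t≤x
  ... | no _    | yes t≤1+s = m≤n⇒m≤n⊔o (toℕ x) t≤1+s
  ... | no t≰x  | no t≰1+s  = contradiction (InversionBelow⇒TailBelow-∷ x w (≰⇒> t≰x)
        (InversionBelow-mono w (≰⇒> t≰1+s) (InversionBelow-punchIn⁺ x u
          (sLabel<⇒InversionBelow u (≤-pred (≤-trans (≰⇒> t≰1+s) t≤1+n)) ≤-refl)))) ¬tailᵥ

sLabel-prepend : ∀ {n} (x : Fin (suc n)) (u : Vec (Fin n) n) → IsPerm u →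
  sLabel (prepend x u) ≡ childS (sLabel u) (toℕ x)
sLabel-prepend         zero    u _    = sLabel-prepend-zero u
sLabel-prepend {suc n} (suc x) u perm = sLabel-prepend-suc x u perm

-- Counting avoiders along the tree

good? : ∀ {n} (v : Vec (Fin n) n) → Dec (IsPerm v × Avoids v)
good? v = isPerm? v ×-dec avoids? v

¬IsPerm-∷ : ∀ {n} {x : Fin (suc n)} (w : Vec (Fin (suc n)) n) i → lookup w i ≡ x → ¬ IsPerm (x ∷ w)
¬IsPerm-∷ w i wᵢ≡x perm with perm (suc i) zero wᵢ≡x
... | ()

weight : ∀ {n} → ℕ → Vec (Fin n) n → ℕ
weight m v = 𝟙 (good? v) * treeCount m (sLabel v) (rLabel v)

weight-bad : ∀ {n} m (v : Vec (Fin n) n) → ¬ (IsPerm v × Avoids v) → weight m v ≡ 0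
weight-bad m v bad = cong (_* treeCount m (sLabel v) (rLabel v)) (𝟙-no (good? v) bad)

weight-prepend : ∀ {n} m (x : Fin (suc n)) (u : Vec (Fin n) n) →
  weight m (prepend x u)
    ≡ 𝟙 (good? u) * (𝟙 (toℕ x ≤? rLabel u) * treeCount m (childS (sLabel u) (toℕ x)) (childR (sLabel u) (toℕ x)))
weight-prepend m x u = cases (good? u) (toℕ x ≤? rLabel u)
  where
  child : ℕ
  child = treeCount m (childS (sLabel u) (toℕ x)) (childR (sLabel u) (toℕ x))
  cases : (good : Dec (IsPerm u × Avoids u)) (x≤r? : Dec (toℕ x ≤ rLabel u)) →
          weight m (prepend x u) ≡ 𝟙 good * (𝟙 x≤r? * child)
  cases (no ¬good) _ = weight-bad m (prepend x u)
    λ (perm , avoids) → ¬good (IsPerm-prepend⁻ x u perm , avoids ∘ Contains-prepend⁺ x u)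
  cases (yes _) (no x≰r) = weight-bad m (prepend x u)
    λ (_ , avoids) → avoids (TailBelow⇒Contains-prepend x u (rLabel<⇒TailBelow u (≤-pred (toℕ<n x)) (≰⇒> x≰r)))
  cases (yes (perm , avoids)) (yes x≤r) = begin
    𝟙 (good? (prepend x u)) * treeCount m (sLabel (prepend x u)) (rLabel (prepend x u))
      ≡⟨ cong₂ _*_ (𝟙-yes (good? (prepend x u)) (IsPerm-prepend x u perm , [ avoids , ¬tail ] ∘ Contains-prepend⁻ x u))
                   (cong₂ (treeCount m) (sLabel-prepend x u perm) (rLabel-prepend x u ¬tail)) ⟩
    1 * child                ≡⟨ cong (1 *_) (*-identityˡ child) ⟨
    1 * (1 * child)          ∎
    where
    ¬tail : ¬ TailBelow u (toℕ x)
    ¬tail = ≤-rLabel⇒¬TailBelow u x≤r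

∑-prepend-weight : ∀ {n} m (u : Vec (Fin n) n) → ∑[ x < suc n ] weight m (prepend x u) ≡ weight (suc m) u
∑-prepend-weight {n} m u = begin
  ∑[ x < suc n ] weight m (prepend x u)
    ≡⟨ sum-cong-≗ {suc n} (λ x → weight-prepend m x u) ⟩
  ∑[ x < suc n ] (𝟙 (good? u) * (𝟙 (toℕ x ≤? rLabel u) * child (toℕ x)))
    ≡⟨ *-distribˡ-sum {suc n} (𝟙 (good? u)) (λ x → 𝟙 (toℕ x ≤? rLabel u) * child (toℕ x)) ⟨
  𝟙 (good? u) * ∑[ x < suc n ] (𝟙 (toℕ x ≤? rLabel u) * child (toℕ x))
    ≡⟨ cong (𝟙 (good? u) *_) (∑-truncate (suc n) child (s≤s (rLabel-≤ u))) ⟩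
  𝟙 (good? u) * ∑[ x < suc (rLabel u) ] child (toℕ x) ∎
  where
  child : ℕ → ℕ
  child y = treeCount m (childS (sLabel u) y) (childR (sLabel u) y)

∑Words-weight : ∀ n m → ∑Words n n (weight m) ≡ treeCount (n + m) 0 0
∑Words-weight zero    m = +-identityʳ (treeCount m 0 0)
∑Words-weight (suc n) m = begin
  ∑[ x < suc n ] ∑Words (suc n) n (λ w → weight m (x ∷ w))
    ≡⟨ sum-cong-≗ {suc n} (λ x → ∑Words-punchIn n n x λ w i wᵢ≡x →
         weight-bad m (x ∷ w) (¬IsPerm-∷ w i wᵢ≡x ∘ proj₁)) ⟩
  ∑[ x < suc n ] ∑Words n n (λ u → weight m (prepend x u))
    ≡⟨ ∑Words-comm n n (suc n) (λ u x → weight m (prepend x u)) ⟨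
  ∑Words n n (λ u → ∑[ x < suc n ] weight m (prepend x u))
    ≡⟨ ∑Words-cong n n (∑-prepend-weight m) ⟩
  ∑Words n n (weight (suc m))
    ≡⟨ ∑Words-weight n (suc m) ⟩
  treeCount (n + suc m) 0 0
    ≡⟨ cong (λ k → treeCount k 0 0) (+-suc n m) ⟩
  treeCount (suc n + m) 0 0 ∎

a≡treeCount : ∀ n → a n ≡ treeCount n 0 0
a≡treeCount n = begin
  a n                            ≡⟨ count-allVecs n n good? ⟩
  ∑Words n n (𝟙 ∘ good?)         ≡⟨ ∑Words-cong n n (λ v → *-identityʳ (𝟙 (good? v))) ⟨
  ∑Words n n (weight 0)          ≡⟨ ∑Words-weight n 0 ⟩
  treeCount (n + 0) 0 0          ≡⟨ cong (λ k → treeCount k 0 0) (+-identityʳ n) ⟩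
  treeCount n 0 0                ∎

a-recurrence : ∀ n → a (2 + n) + 3 * a n ≡ 4 * a (1 + n) + 1
a-recurrence n = begin
  a (2 + n) + 3 * a n
    ≡⟨ cong₂ (λ p q → p + 3 * q) (a≡treeCount (2 + n)) (a≡treeCount n) ⟩
  treeCount (2 + n) 0 0 + 3 * treeCount n 0 0
    ≡⟨ treeCount-recurrence n ⟩
  4 * treeCount (1 + n) 0 0 + 1
    ≡⟨ cong (λ p → 4 * p + 1) (a≡treeCount (1 + n)) ⟨
  4 * a (1 + n) + 1 ∎

theorem10 : (a 0 ≡ 1) × (a 1 ≡ 1)
    × (∀ n → a (suc (suc n)) + 3 * a n ≡ 4 * a (suc n) + 1)
    × (∀ n → 4 * a n + 2 * n ≡ 3 ^ n + 3)
    × (∀ n → polyMul (+ 1 ∷ -[1+ 4 ] ∷ + 7 ∷ -[1+ 2 ] ∷ []) (λ k → + a k) n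
    ≡ poly (+ 1 ∷ -[1+ 3 ] ∷ + 4 ∷ []) n)
theorem10 =
  refl , refl , a-recurrence ,
  closed-form a refl refl a-recurrence ,
  generating-function a refl refl a-recurrence
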